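{- Let $G$ be a finite simple graph and let $w:E(G)\rightarrow \mathbb{Q}^+$ be a weight function taking exactly the values $w_1<w_2<\dots<w_t$ (with $t\geq 2$), and let $\varepsilon\in(0,1)$ be rational. Assume that \[w_2-w_1\leq \frac{\varepsilon}{t}\cdot w_1.\] Let $w'$ be the weight function on $E(G)$ that coincides with $w$ except that every edge with $w$-weight $w_1$ has $w'$-weight $w_2$. Let $OPT$ and $OPT'$ denote the maximum weight of a matching of $G$ with respect to $w$ and $w'$, respectively, and let $\theta=\frac{t-1}{t}\cdot\varepsilon$. If $M$ is a matching of $G$ with $w'(M)\geq (1-\theta)\cdot OPT'$, then $w(M)\geq(1-\varepsilon)\cdot OPT$.
   Context: A matching in a graph is a set of edges no two of which share a vertex. For a weight function $w$ and a set of edges $M$, $w(M)=\sum_{e\in M}w(e)$. $\mathbb{Q}^+$ denotes the positive rationals. -}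

module Defs where

open import Data.Nat using (ℕ; zero; suc)
open import Data.Fin using (Fin)
import Data.Fin
open import Data.Fin.Subset using (Subset; _∈_)
open import Data.Vec using ([]; _∷_)
open import Data.Bool using (Bool; true; false; if_then_else_)
open import Data.Product using (_×_; _,_; proj₁; proj₂; Σ; ∃)
open import Data.Sum using (_⊎_)
open import Data.Rational using (ℚ; 0ℚ; _+_; _≤_)
open import Data.Rational.Properties using (_≟_)
open import Relation.Nullary using (¬_; does)
open import Relation.Binary.PropositionalEquality using (_≡_; _≢_)

record SimpleGraph : Set where
  field
    n    : ℕ
    m    : ℕ
    ends : Fin m → Fin n × Fin n
    noLoop : ∀ e → proj₁ (ends e) ≢ proj₂ (ends e)
    noMulti : ∀ e f →
      (proj₁ (ends e) ≡ proj₁ (ends f) × proj₂ (ends e) ≡ proj₂ (ends f)) ⊎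
      (proj₁ (ends e) ≡ proj₂ (ends f) × proj₂ (ends e) ≡ proj₁ (ends f)) →
      e ≡ f

open SimpleGraph public

Incident : (G : SimpleGraph) → Fin (m G) → Fin (n G) → Set
Incident G e v = (proj₁ (ends G e) ≡ v) ⊎ (proj₂ (ends G e) ≡ v)

IsMatching : (G : SimpleGraph) → Subset (m G) → Set
IsMatching G M = ∀ e f → e ∈ M → f ∈ M → e ≢ f →
  ∀ v → ¬ (Incident G e v × Incident G f v)

weightOf : ∀ {k} → (Fin k → ℚ) → Subset k → ℚ
weightOf {zero}  w []       = 0ℚ
weightOf {suc k} w (b ∷ M) =
  (if b then w Data.Fin.zero else 0ℚ) + weightOf (λ i → w (Data.Fin.suc i)) M

IsMaxMatchingWeight : (G : SimpleGraph) → (Fin (m G) → ℚ) → ℚ → Set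
IsMaxMatchingWeight G w opt =
  (Σ (Subset (m G)) λ M → IsMatching G M × weightOf w M ≡ opt) ×
  (∀ M → IsMatching G M → weightOf w M ≤ opt)

raiseWeight : ∀ {k} → (Fin k → ℚ) → ℚ → ℚ → (Fin k → ℚ)
raiseWeight w a b e = if does (w e ≟ a) then b else w e

-- Raising the weight w₁ to w₂ multiplies each edge weight by at most
-- 1 + ε/t, so w ≤ w' ≤ (1 + ε/t)·w edgewise.  Hence OPT ≤ OPT', and
-- (1 − θ)·OPT ≤ (1 − θ)·OPT' ≤ w'(M) ≤ (1 + ε/t)·w(M).  Since
-- 1 − θ = 1 − ε + ε/t ≥ (1 + ε/t)(1 − ε), dividing by 1 + ε/t gives the claim.
-- Of the ordering of the weight values only w₁ < w₂ is used, and M need not be a matching.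
module Submission where

open import Defs
open import Data.Nat using (ℕ; zero; suc)
open import Data.Fin using (Fin)
import Data.Fin
open import Data.Fin.Subset using (Subset)
open import Data.Integer using (+_)
open import Data.Product using (∃)
open import Data.Rational using (ℚ; 0ℚ; 1ℚ; _/_; _+_; _-_; _*_; _≤_; _<_)
open import Relation.Binary.PropositionalEquality using (_≡_)

import Data.Nat as ℕ
open import Data.Nat.Tactic.RingSolver using (solve-∀)
open import Data.Product using (_,_)
open import Data.Vec using ([]; _∷_)
open import Data.Bool using (true; false)
open import Data.Fin.Subset using (⊥)
open import Data.Fin.Subset.Properties using (∉⊥)
open import Data.Rational using (toℚᵘ; -_; nonNegative; positive)
open import Data.Rational.Properties
import Data.Rational.Unnormalised as ℚᵘ
import Data.Rational.Unnormalised.Properties as ℚᵘ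
open import Data.Rational.Solver using (module +-*-Solver)
open import Relation.Binary.PropositionalEquality using (refl; sym; trans; cong; subst)
open import Relation.Nullary using (yes; no)
open import Function using (_∘_)
import Data.Empty
open import Data.Fin using () renaming (zero to fzero; suc to fsuc)
open +-*-Solver

[1+n]/[2+n]≡1-1/[2+n] : ∀ n → + suc n / suc (suc n) ≡ 1ℚ - + 1 / suc (suc n)
[1+n]/[2+n]≡1-1/[2+n] n = trans (solve 2 (λ p q → p := (p :+ q) :- q) refl (+ suc n / t) (+ 1 / t))
                             (cong (_- + 1 / t) sum≡1)
  where
  t : ℕ
  t = suc (suc n)
  cross-multiplied : ∀ m → ((1 ℕ.+ m) ℕ.* (2 ℕ.+ m) ℕ.+ 1 ℕ.* (2 ℕ.+ m)) ℕ.* 1 ≡ 1 ℕ.* ((2 ℕ.+ m) ℕ.* (2 ℕ.+ m))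
  cross-multiplied = solve-∀
  sum≡1 : + suc n / t + + 1 / t ≡ 1ℚ
  sum≡1 = toℚᵘ-injective (ℚᵘ.≃-trans (toℚᵘ-homo-+ (+ suc n / t) (+ 1 / t))
            (ℚᵘ.≃-trans (ℚᵘ.+-cong (toℚᵘ-fromℚᵘ (+ suc n ℚᵘ./ t)) (toℚᵘ-fromℚᵘ (+ 1 ℚᵘ./ t)))
              (ℚᵘ.*≡* (cong +_ (cross-multiplied n)))))

*-nonNeg : ∀ {p q} → 0ℚ ≤ p → 0ℚ ≤ q → 0ℚ ≤ p * q
*-nonNeg {p} {q} 0≤p 0≤q =
  nonNegative⁻¹ _ {{nonNeg*nonNeg⇒nonNeg p {{nonNegative 0≤p}} q {{nonNegative 0≤q}}}}

p≤p+q : ∀ {p q} → 0ℚ ≤ q → p ≤ p + q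
p≤p+q {p} 0≤q = ≤-trans (≤-reflexive (sym (+-identityʳ p))) (+-monoʳ-≤ p 0≤q)

p≤[1+a]*p : ∀ {a p} → 0ℚ ≤ a → 0ℚ ≤ p → p ≤ (1ℚ + a) * p
p≤[1+a]*p {a} {p} 0≤a 0≤p = ≤-trans (p≤p+q (*-nonNeg 0≤a 0≤p))
  (≤-reflexive (solve 2 (λ a p → p :+ a :* p := (con 1ℚ :+ a) :* p) refl a p))

q-p≤a*p⇒q≤[1+a]*p : ∀ {a p q} → q - p ≤ a * p → q ≤ (1ℚ + a) * p
q-p≤a*p⇒q≤[1+a]*p {a} {p} {q} q-p≤a*p = begin
  q             ≡⟨ solve 2 (λ p q → q := (q :- p) :+ p) refl p q ⟩
  (q - p) + p   ≤⟨ +-monoˡ-≤ p q-p≤a*p ⟩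
  a * p + p     ≡⟨ solve 2 (λ a p → a :* p :+ p := (con 1ℚ :+ a) :* p) refl a p ⟩
  (1ℚ + a) * p  ∎
  where open ≤-Reasoning

1-[1-u]*ε≡1-ε+ε*u : ∀ u ε → 1ℚ - (1ℚ - u) * ε ≡ (1ℚ - ε) + ε * u
1-[1-u]*ε≡1-ε+ε*u = solve 2 (λ u ε → con 1ℚ :- (con 1ℚ :- u) :* ε := (con 1ℚ :- ε) :+ ε :* u) refl

1-[1-u]*ε-nonNeg : ∀ {u ε} → 0ℚ ≤ u → 0ℚ ≤ ε → ε ≤ 1ℚ → 0ℚ ≤ 1ℚ - (1ℚ - u) * ε
1-[1-u]*ε-nonNeg {u} {ε} 0≤u 0≤ε ε≤1 = subst (0ℚ ≤_) (sym (1-[1-u]*ε≡1-ε+ε*u u ε))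
  (≤-trans (p≤q⇒0≤q-p ε≤1) (p≤p+q (*-nonNeg 0≤ε 0≤u)))
  where
  p≤q⇒0≤q-p : ∀ {p q} → p ≤ q → 0ℚ ≤ q - p
  p≤q⇒0≤q-p {p} {q} p≤q = ≤-trans (≤-reflexive (sym (+-inverseʳ p))) (+-monoˡ-≤ (- p) p≤q)

[1+ε*u]*[1-ε]≤1-[1-u]*ε : ∀ {u ε x} → 0ℚ ≤ u → 0ℚ ≤ ε → 0ℚ ≤ x →
  (1ℚ + ε * u) * ((1ℚ - ε) * x) ≤ (1ℚ - (1ℚ - u) * ε) * x
[1+ε*u]*[1-ε]≤1-[1-u]*ε {u} {ε} {x} 0≤u 0≤ε 0≤x = begin
  (1ℚ + ε * u) * ((1ℚ - ε) * x)
    ≤⟨ p≤p+q (*-nonNeg (*-nonNeg (*-nonNeg 0≤ε 0≤ε) 0≤u) 0≤x) ⟩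
  (1ℚ + ε * u) * ((1ℚ - ε) * x) + ((ε * ε) * u) * x
    ≡⟨ solve 3 (λ ε u x → (con 1ℚ :+ ε :* u) :* ((con 1ℚ :- ε) :* x) :+ ((ε :* ε) :* u) :* x
                         := ((con 1ℚ :- ε) :+ ε :* u) :* x) refl ε u x ⟩
  ((1ℚ - ε) + ε * u) * x
    ≡⟨ cong (_* x) (sym (1-[1-u]*ε≡1-ε+ε*u u ε)) ⟩
  (1ℚ - (1ℚ - u) * ε) * x ∎
  where open ≤-Reasoning

weightOf-mono : ∀ {k} {f g : Fin k → ℚ} → (∀ e → f e ≤ g e) → ∀ M → weightOf f M ≤ weightOf g M
weightOf-mono {zero}  f≤g []          = ≤-refl
weightOf-mono {suc k} f≤g (true ∷ M)  = +-mono-≤ (f≤g fzero) (weightOf-mono (f≤g ∘ fsuc) M)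
weightOf-mono {suc k} f≤g (false ∷ M) = +-monoʳ-≤ 0ℚ (weightOf-mono (f≤g ∘ fsuc) M)

weightOf-* : ∀ {k} c (f : Fin k → ℚ) M → weightOf (λ e → c * f e) M ≡ c * weightOf f M
weightOf-* {zero}  c f []          = sym (*-zeroʳ c)
weightOf-* {suc k} c f (true ∷ M)  =
  trans (cong (_+_ (c * f fzero)) (weightOf-* c (f ∘ fsuc) M)) (sym (*-distribˡ-+ c _ _))
weightOf-* {suc k} c f (false ∷ M) =
  trans (+-identityˡ _) (trans (weightOf-* c (f ∘ fsuc) M) (cong (c *_) (sym (+-identityˡ _))))

weightOf-⊥ : ∀ {k} (f : Fin k → ℚ) → weightOf f ⊥ ≡ 0ℚ
weightOf-⊥ {zero}  f = refl
weightOf-⊥ {suc k} f = trans (+-identityˡ _) (weightOf-⊥ (f ∘ fsuc))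

⊥-isMatching : ∀ G → IsMatching G ⊥
⊥-isMatching G e _ e∈⊥ _ _ _ _ = Data.Empty.⊥-elim (∉⊥ e∈⊥)

maxMatchingWeight-nonNeg : ∀ G {w opt} → IsMaxMatchingWeight G w opt → 0ℚ ≤ opt
maxMatchingWeight-nonNeg G {w} (_ , maximal) =
  subst (_≤ _) (weightOf-⊥ w) (maximal ⊥ (⊥-isMatching G))

maxMatchingWeight-mono : ∀ G {f g opt opt'} → (∀ e → f e ≤ g e) →
  IsMaxMatchingWeight G f opt → IsMaxMatchingWeight G g opt' → opt ≤ opt'
maxMatchingWeight-mono G {opt' = opt'} f≤g ((N , N-matching , f[N]≡opt) , _) (_ , g-maximal) =
  subst (_≤ opt') f[N]≡opt (≤-trans (weightOf-mono f≤g N) (g-maximal N N-matching))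

approximation-transfer : ∀ G {f g c r opt opt'} → (∀ e → f e ≤ g e) → (∀ e → g e ≤ c * f e) →
  IsMaxMatchingWeight G f opt → IsMaxMatchingWeight G g opt' → 0ℚ ≤ r →
  ∀ M → r * opt' ≤ weightOf g M → r * opt ≤ c * weightOf f M
approximation-transfer G {f} {g} {c} {r} {opt} {opt'} f≤g g≤c*f max-f max-g 0≤r M r*opt'≤g[M] = begin
  r * opt                     ≤⟨ *-monoˡ-≤-nonNeg r {{nonNegative 0≤r}} (maxMatchingWeight-mono G f≤g max-f max-g) ⟩
  r * opt'                    ≤⟨ r*opt'≤g[M] ⟩
  weightOf g M                ≤⟨ weightOf-mono g≤c*f M ⟩
  weightOf (λ e → c * f e) M  ≡⟨ weightOf-* c f M ⟩
  c * weightOf f M            ∎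
  where open ≤-Reasoning

raiseWeight-≥ : ∀ {k} (w : Fin k → ℚ) {a b} → a ≤ b → ∀ e → w e ≤ raiseWeight w a b e
raiseWeight-≥ w {a} a≤b e with w e ≟ a
... | yes w[e]≡a = subst (_≤ _) (sym w[e]≡a) a≤b
... | no _       = ≤-refl

raiseWeight-≤-* : ∀ {k} (w : Fin k → ℚ) {a b c} → b ≤ c * a → (∀ e → w e ≤ c * w e) →
  ∀ e → raiseWeight w a b e ≤ c * w e
raiseWeight-≤-* w {a} {b} {c} b≤c*a w≤c*w e with w e ≟ a
... | yes w[e]≡a = subst (λ x → b ≤ c * x) (sym w[e]≡a) b≤c*a
... | no _       = w≤c*w e

corollary1 : (G : SimpleGraph) (w : Fin (m G) → ℚ)
    (k : ℕ) (ws : Fin (suc (suc k)) → ℚ) (ε : ℚ) →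
    let t = suc (suc k)
        w₁ = ws Data.Fin.zero
        w₂ = ws (Data.Fin.suc Data.Fin.zero)
    in
    (∀ e → 0ℚ < w e) →
    (∀ (i j : Fin t) → Data.Fin._<_ i j → ws i < ws j) →
    (∀ e → ∃ λ i → w e ≡ ws i) →
    (∀ i → ∃ λ e → w e ≡ ws i) →
    0ℚ < ε → ε < 1ℚ →
    w₂ - w₁ ≤ (ε * (+ 1 / t)) * w₁ →
    (OPT OPT' : ℚ) →
    IsMaxMatchingWeight G w OPT →
    IsMaxMatchingWeight G (raiseWeight w w₁ w₂) OPT' →
    (M : Subset (m G)) → IsMatching G M →
    (1ℚ - ((+ (t Data.Nat.∸ 1) / t) * ε)) * OPT' ≤ weightOf (raiseWeight w w₁ w₂) M →
    (1ℚ - ε) * OPT ≤ weightOf w M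
corollary1 G w k ws ε w>0 ws-increasing _ _ ε>0 ε<1 gap OPT OPT' max-w max-w' M _ approx =
  *-cancelˡ-≤-pos (1ℚ + a) {{positive 0<1+a}} (begin
    (1ℚ + a) * ((1ℚ - ε) * OPT)
      ≤⟨ [1+ε*u]*[1-ε]≤1-[1-u]*ε {u} {ε} {OPT} 0≤u 0≤ε (maxMatchingWeight-nonNeg G max-w) ⟩
    (1ℚ - (1ℚ - u) * ε) * OPT
      ≤⟨ approximation-transfer G {c = 1ℚ + a} w≤w' w'≤[1+a]*w max-w max-w' 0≤1-θ M approx' ⟩
    (1ℚ + a) * weightOf w M ∎)
  where
  open ≤-Reasoning
  u a : ℚ
  u = + 1 / suc (suc k)
  a = ε * u
  w' : Fin (m G) → ℚ
  w' = raiseWeight w (ws fzero) (ws (fsuc fzero))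
  0≤u : 0ℚ ≤ u
  0≤u = nonNegative⁻¹ u {{normalize-nonNeg 1 (suc (suc k))}}
  0≤ε : 0ℚ ≤ ε
  0≤ε = <⇒≤ ε>0
  0≤a : 0ℚ ≤ a
  0≤a = *-nonNeg 0≤ε 0≤u
  0<1+a : 0ℚ < 1ℚ + a
  0<1+a = <-≤-trans (positive⁻¹ 1ℚ) (p≤p+q 0≤a)
  0≤1-θ : 0ℚ ≤ 1ℚ - (1ℚ - u) * ε
  0≤1-θ = 1-[1-u]*ε-nonNeg 0≤u 0≤ε (<⇒≤ ε<1)
  approx' : (1ℚ - (1ℚ - u) * ε) * OPT' ≤ weightOf w' M
  approx' = subst (λ v → (1ℚ - v * ε) * OPT' ≤ weightOf w' M) ([1+n]/[2+n]≡1-1/[2+n] k) approx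
  w≤w' : ∀ e → w e ≤ w' e
  w≤w' = raiseWeight-≥ w (<⇒≤ (ws-increasing fzero (fsuc fzero) (ℕ.s≤s ℕ.z≤n)))
  w'≤[1+a]*w : ∀ e → w' e ≤ (1ℚ + a) * w e
  w'≤[1+a]*w = raiseWeight-≤-* w {c = 1ℚ + a} (q-p≤a*p⇒q≤[1+a]*p {a} gap)
                 (λ e → p≤[1+a]*p {a} 0≤a (<⇒≤ (w>0 e)))
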